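{- Let $\mathfrak{G}=(Y,R,E)$ be a descriptive $\mathsf{MS4}$-frame with skeleton $\rho\mathfrak{G}=(X,R',Q')$. Then $\mathfrak{G}$ satisfies the global Kuroda principle (for every $x\in\operatorname{qmax}Y$, $E[x]\subseteq\operatorname{qmax}Y$) if and only if $\rho\mathfrak{G}$ satisfies the Kuroda principle ($E_{Q'}[\max X]=\max X$).
   Context: An $\mathsf{MS4}$-frame is $(Y,R,E)$ with $R$ a quasi-order, $E$ an equivalence relation, and: if $xEy$ and $yRz$ then there is $u$ with $xRu$ and $uEz$. It is descriptive if $Y$ carries a Stone topology in which $R$ and $E$ are continuous ($S[x]=\{y:xSy\}$ closed for all $x$, $S^{ -1}[U]$ clopen for clopen $U$). $\operatorname{qmax}Y=\{x:xRy\Rightarrow yRx\}$. For a quasi-order $S$, $xE_Sy$ iff $xSy$ and $ySx$. Let $Q=E\circ R$ ($xQy$ iff $xRz$ and $zEy$ for some $z$). The skeleton $\rho\mathfrak{G}=(X,R',Q')$ has $X=Y/E_R$ with quotient map $\pi$, $\pi(x)R'\pi(y)$ iff $xRy$, and $\pi(x)Q'\pi(y)$ iff $xQy$. $\max X=\{x\in X: xR'y\Rightarrow x=y\}$, and $E_{Q'}[A]=\{y:\exists a\in A,\ aE_{Q'}y\}$. -}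

module Defs where

open import Data.Product using (Σ; ∃; _×_; _,_)
open import Data.List using (List)
open import Data.List.Relation.Unary.Any using (Any)
open import Relation.Binary.PropositionalEquality using (_≡_)
open import Relation.Nullary using (¬_)
open import Data.Empty using (⊥)
open import Data.Unit using (⊤)

Pred : Set → Set₁
Pred Y = Y → Set

Rel : Set → Set₁
Rel Y = Y → Y → Set

_⊆_ : {Y : Set} → Pred Y → Pred Y → Set
A ⊆ B = ∀ y → A y → B y

_≐_ : {Y : Set} → Pred Y → Pred Y → Set
A ≐ B = (A ⊆ B) × (B ⊆ A)

∁ : {Y : Set} → Pred Y → Pred Y
∁ A y = ¬ A y

record Topology (Y : Set) : Set₁ where
  field
    IsOpen    : Pred Y → Set
    open-full : IsOpen (λ _ → ⊤)
    open-∩    : ∀ U V → IsOpen U → IsOpen V → IsOpen (λ y → U y × V y)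
    open-⋃    : {I : Set} (U : I → Pred Y) → (∀ i → IsOpen (U i)) →
                IsOpen (λ y → ∃ λ i → U i y)

module _ {Y : Set} (τ : Topology Y) where
  open Topology τ

  IsClosed : Pred Y → Set
  IsClosed U = IsOpen (∁ U)

  IsClopen : Pred Y → Set
  IsClopen U = IsOpen U × IsClosed U

  Compact : Set₁
  Compact = {I : Set} (U : I → Pred Y) → (∀ i → IsOpen (U i)) →
            (∀ y → ∃ λ i → U i y) →
            ∃ λ (is : List I) → ∀ y → Any (λ i → U i y) is

  Hausdorff : Set₁
  Hausdorff = ∀ x y → ¬ (x ≡ y) →
    ∃ λ (U : Pred Y) → ∃ λ (V : Pred Y) →
      IsOpen U × IsOpen V × U x × V y × (∀ z → U z → V z → ⊥)

  ZeroDimensional : Set₁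
  ZeroDimensional = ∀ (U : Pred Y) → IsOpen U → ∀ x → U x →
    ∃ λ (C : Pred Y) → IsClopen C × C x × (C ⊆ U)

  Stone : Set₁
  Stone = Compact × Hausdorff × ZeroDimensional

_[_] : {Y : Set} → Rel Y → Y → Pred Y
(S [ x ]) y = S x y

_⁻¹[_] : {Y : Set} → Rel Y → Pred Y → Pred Y
(S ⁻¹[ U ]) y = ∃ λ z → S y z × U z

record IsQuasiOrder {Y : Set} (R : Rel Y) : Set where
  field
    refl  : ∀ x → R x x
    trans : ∀ x y z → R x y → R y z → R x z

record IsEquivalence {Y : Set} (E : Rel Y) : Set where
  field
    refl  : ∀ x → E x x
    sym   : ∀ x y → E x y → E y x
    trans : ∀ x y z → E x y → E y z → E x z

Continuous : {Y : Set} → Topology Y → Rel Y → Set₁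
Continuous τ S =
  (∀ x → IsClosed τ (S [ x ])) ×
  (∀ U → IsClopen τ U → IsClopen τ (S ⁻¹[ U ]))

record MS4Frame : Set₁ where
  field
    Y   : Set
    R   : Rel Y
    E   : Rel Y
    R-qo : IsQuasiOrder R
    E-eq : IsEquivalence E
    comm : ∀ x y z → E x y → R y z → ∃ λ u → R x u × E u z

record DescriptiveMS4Frame : Set₁ where
  field
    frame : MS4Frame
  open MS4Frame frame public
  field
    τ      : Topology Y
    stone  : Stone τ
    R-cont : Continuous τ R
    E-cont : Continuous τ E

module _ (𝔊 : MS4Frame) where
  open MS4Frame 𝔊

  qmax : Pred Y
  qmax x = ∀ y → R x y → R y x

  GlobalKuroda : Set
  GlobalKuroda = ∀ x → qmax x → (E [ x ]) ⊆ qmax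

  E[_] : Rel Y → Rel Y
  E[ S ] x y = S x y × S y x

  Q : Rel Y
  Q x y = ∃ λ z → R x z × E z y

  -- Skeleton ρ𝔊 = (X, R', Q') with X = Y / E_R.
  -- Since Agda has no quotient types, X is represented by Y together
  -- with the equality _≈X_ = E_R (the quotient map π is the identity
  -- on representatives); R' and Q' are defined on representatives,
  -- which is exactly the definition π(x) R' π(y) iff x R y, etc.

  X : Set
  X = Y

  _≈X_ : Rel X
  _≈X_ = E[ R ]

  R' : Rel X
  R' x y = R x y

  Q' : Rel X
  Q' x y = Q x y

  maxX : Pred X
  maxX x = ∀ y → R' x y → x ≈X y

  EQ'[_] : Pred X → Pred X
  EQ'[ A ] y = ∃ λ a → A a × E[ Q' ] a y

  SkeletonKuroda : Set
  SkeletonKuroda = EQ'[ maxX ] ≐ maxX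

module Submission where

open import Defs
open import Function.Bundles using (_⇔_; mk⇔)
open import Data.Product using (_,_; proj₁; proj₂)

-- Quasi-maximal points are exactly the representatives of maximal points of
-- the skeleton, and qmax is upward closed along R from a qmax point. So a
-- point E_{Q'}-related to a maximal a lies in E[z] for some qmax z with a R z,
-- while conversely x E y with x quasi-maximal gives x E_{Q'} y.

module _ (F : MS4Frame) where
  open MS4Frame F
  open IsQuasiOrder R-qo renaming (refl to R-refl; trans to R-trans)
  open IsEquivalence E-eq renaming (refl to E-refl; sym to E-sym)

  qmax⇒maxX : qmax F ⊆ maxX F
  qmax⇒maxX x qx y xRy = xRy , qx y xRy

  maxX⇒qmax : maxX F ⊆ qmax F
  maxX⇒qmax x mx y xRy = proj₂ (mx y xRy)

  qmax-R-closed : ∀ x y → qmax F x → R x y → qmax F y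
  qmax-R-closed x y qx xRy z yRz =
    R-trans z x y (qx z (R-trans x y z xRy yRz)) xRy

  E⇒Q : ∀ x y → E x y → Q F x y
  E⇒Q x y xEy = x , R-refl x , xEy

  E⇒E[Q] : ∀ x y → E x y → E[_] F (Q F) x y
  E⇒E[Q] x y xEy = E⇒Q x y xEy , E⇒Q y x (E-sym x y xEy)

  maxX⊆EQ'[maxX] : maxX F ⊆ EQ'[_] F (maxX F)
  maxX⊆EQ'[maxX] y my = y , my , E⇒E[Q] y y (E-refl y)

  globalKuroda⇒skeletonKuroda : GlobalKuroda F → SkeletonKuroda F
  globalKuroda⇒skeletonKuroda gk = EQ'[maxX]⊆maxX , maxX⊆EQ'[maxX]
    where
    EQ'[maxX]⊆maxX : EQ'[_] F (maxX F) ⊆ maxX F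
    EQ'[maxX]⊆maxX y (a , ma , (z , aRz , zEy) , _) =
      qmax⇒maxX y (gk z (qmax-R-closed a z (maxX⇒qmax a ma) aRz) y zEy)

  skeletonKuroda⇒globalKuroda : SkeletonKuroda F → GlobalKuroda F
  skeletonKuroda⇒globalKuroda (EQ'[maxX]⊆maxX , _) x qx y xEy =
    maxX⇒qmax y (EQ'[maxX]⊆maxX y (x , qmax⇒maxX x qx , E⇒E[Q] x y xEy))

proposition3p12 : (𝔊 : DescriptiveMS4Frame) →
    GlobalKuroda (DescriptiveMS4Frame.frame 𝔊) ⇔ SkeletonKuroda (DescriptiveMS4Frame.frame 𝔊)
proposition3p12 𝔊 = mk⇔ (globalKuroda⇒skeletonKuroda F) (skeletonKuroda⇒globalKuroda F)
  where F = DescriptiveMS4Frame.frame 𝔊
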